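{- Let $h:\mathbb{Z}_{\ge0}\to\mathbb{Z}_{\ge0}$ be a monotonically increasing function with the NS-property. Then for all integers $z\ge16$ and $y\ge 0$ with $y\le h(z)$, we have $y\oplus z\ge16$.
   Context: A function $h:\mathbb{Z}_{\ge0}\to\mathbb{Z}_{\ge0}$ is monotonically increasing if $h(u)\le h(v)$ whenever $u\le v$. Such an $h$ has the NS-property if both of the following hold: - $h(0)=0$; - for all $z,z'\in\mathbb{Z}_{\ge0}$ and every positive integer $i$, $\lfloor z/2^i\rfloor=\lfloor z'/2^i\rfloor$ implies $\lfloor h(z)/2^{i-1}\rfloor=\lfloor h(z')/2^{i-1}\rfloor$. The symbol $\oplus$ denotes bitwise XOR of nonnegative integers. -}

module Defs where

open import Data.Nat using (ℕ; zero; suc; _+_; _*_; _^_; _≤_; _≡ᵇ_)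
open import Data.Nat.DivMod using (_/_; _%_)
open import Data.Bool using (Bool; true; false; if_then_else_; _xor_)
open import Data.Product using (_×_)
open import Relation.Binary.PropositionalEquality using (_≡_)

-- The fuel argument bounds the number of bits processed; a + b + 1 fuel
-- is always sufficient (each step halves both arguments).
xor-fuel : ℕ → ℕ → ℕ → ℕ
xor-fuel zero    a b = 0
xor-fuel (suc f) a b =
  (if ((a % 2) ≡ᵇ 1) xor ((b % 2) ≡ᵇ 1) then 1 else 0)
  + 2 * xor-fuel f (a / 2) (b / 2)

infixl 6 _⊕_
_⊕_ : ℕ → ℕ → ℕ
a ⊕ b = xor-fuel (suc (a + b)) a b

Monotone : (ℕ → ℕ) → Set
Monotone h = ∀ u v → u ≤ v → h u ≤ h v

shr : ℕ → ℕ → ℕ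
shr z zero    = z
shr z (suc i) = shr (z / 2) i

-- NS-property (the positive integer i of the paper is suc i here)
NSProperty : (ℕ → ℕ) → Set
NSProperty h =
  (h 0 ≡ 0) ×
  (∀ z z' i → shr z (suc i) ≡ shr z' (suc i) →
     shr (h z) i ≡ shr (h z') i)

private
  open import Relation.Binary.PropositionalEquality using (refl)
  t1 : 5 ⊕ 3 ≡ 6
  t1 = refl
  t2 : 16 ⊕ 31 ≡ 15
  t2 = refl
  t3 : shr 37 3 ≡ 4
  t3 = refl

-- Let k be the position of the leading bit of z; as z ≥ 16, k ≥ 4. Since z and 0 agree above
-- bit k, the NS-property makes h z and h 0 = 0 agree from bit k on, so h z < 2^k and hence
-- y < 2^k. Bit k of y ⊕ z is therefore that of z, namely 1, giving y ⊕ z ≥ 2^k ≥ 16.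
module Submission where

open import Defs
open import Data.Bool using (Bool; true; false; if_then_else_; _xor_)
open import Data.Nat using (ℕ; zero; suc; _+_; _*_; _^_; _∸_; _≡ᵇ_; _≤_; _<_; s≤s; z≤n)
open import Data.Nat.DivMod
  using (_/_; _%_; m*n/n≡m; m/n*n≤m; m/n<m; m≥n⇒m/n>0; /-monoˡ-≤; +-distrib-/-∣ʳ)
open import Data.Nat.Divisibility using (divides)
open import Data.Nat.Induction using (<-wellFounded)
open import Data.Nat.Properties
open import Data.Product using (∃-syntax; _×_; _,_)
open import Induction.WellFounded using (Acc; acc)
open import Relation.Binary.PropositionalEquality
  using (_≡_; refl; sym; trans; cong; module ≡-Reasoning)

n<2^n : ∀ n → n < 2 ^ n
n<2^n zero    = s≤s z≤n
n<2^n (suc n) = begin-strict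
  suc n         ≤⟨ n<2^n n ⟩
  2 ^ n         <⟨ m<m+n (2 ^ n) (m^n>0 2 n) ⟩
  2 ^ n + 2 ^ n ≡⟨ cong (2 ^ n +_) (sym (+-identityʳ (2 ^ n))) ⟩
  2 * 2 ^ n     ∎
  where open ≤-Reasoning

2*n/2≡n : ∀ n → 2 * n / 2 ≡ n
2*n/2≡n n = trans (cong (_/ 2) (*-comm 2 n)) (m*n/n≡m n 2)

[b+2*n]/2≡n : ∀ (b : Bool) n → ((if b then 1 else 0) + 2 * n) / 2 ≡ n
[b+2*n]/2≡n false n = 2*n/2≡n n
[b+2*n]/2≡n true  n = trans (+-distrib-/-∣ʳ 1 (divides n (*-comm 2 n))) (2*n/2≡n n)

shr-0 : ∀ k → shr 0 k ≡ 0
shr-0 zero    = refl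
shr-0 (suc k) = shr-0 k

shr-suc : ∀ z k → shr z (suc k) ≡ shr z k / 2
shr-suc z zero    = refl
shr-suc z (suc k) = shr-suc (z / 2) k

shr-+ : ∀ z m n → shr z (m + n) ≡ shr (shr z m) n
shr-+ z zero    n = refl
shr-+ z (suc m) n = shr-+ (z / 2) m n

shr-mono : ∀ {y z} k → y ≤ z → shr y k ≤ shr z k
shr-mono zero    y≤z = y≤z
shr-mono (suc k) y≤z = shr-mono k (/-monoˡ-≤ 2 y≤z)

2^≤⇒shr-pos : ∀ {w} k → 2 ^ k ≤ w → 1 ≤ shr w k
2^≤⇒shr-pos zero    1≤w = 1≤w
2^≤⇒shr-pos {w} (suc k) 2^[1+k]≤w = 2^≤⇒shr-pos k (begin
  2 ^ k         ≡⟨ sym (2*n/2≡n (2 ^ k)) ⟩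
  2 * 2 ^ k / 2 ≤⟨ /-monoˡ-≤ 2 2^[1+k]≤w ⟩
  w / 2         ∎)
  where open ≤-Reasoning

shr-pos⇒2^≤ : ∀ {w} k → 1 ≤ shr w k → 2 ^ k ≤ w
shr-pos⇒2^≤ zero    1≤w = 1≤w
shr-pos⇒2^≤ {w} (suc k) 1≤shr = begin
  2 * 2 ^ k   ≤⟨ *-monoʳ-≤ 2 (shr-pos⇒2^≤ k 1≤shr) ⟩
  2 * (w / 2) ≡⟨ *-comm 2 (w / 2) ⟩
  w / 2 * 2   ≤⟨ m/n*n≤m w 2 ⟩
  w           ∎
  where open ≤-Reasoning

leading-bit : ∀ z → 1 ≤ z → ∃[ k ] shr z k ≡ 1
leading-bit z = go z (<-wellFounded z)
  where
  go : ∀ z → Acc _<_ z → 1 ≤ z → ∃[ k ] shr z k ≡ 1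
  go 1               _         _ = 0 , refl
  go z@(suc (suc _)) (acc rec) _
    with go (z / 2) (rec (m/n<m z 2 ≤-refl)) (m≥n⇒m/n>0 {z} (s≤s (s≤s z≤n)))
  ... | k , zₖ≡1 = suc k , zₖ≡1

leading-bit-above : ∀ n z → 2 ^ n ≤ z → ∃[ k ] n ≤ k × shr z k ≡ 1
leading-bit-above n z 2^n≤z with leading-bit (shr z n) (2^≤⇒shr-pos n 2^n≤z)
... | j , e = n + j , m≤m+n n j , trans (shr-+ z n j) e

shr-xor-fuel : ∀ f k y z → shr (xor-fuel f y z) k ≡ xor-fuel (f ∸ k) (shr y k) (shr z k)
shr-xor-fuel f       zero    y z = refl
shr-xor-fuel zero    (suc k) y z = shr-0 (suc k)
shr-xor-fuel (suc f) (suc k) y z =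
  trans (cong (λ w → shr w k) ([b+2*n]/2≡n low-bit (xor-fuel f (y / 2) (z / 2))))
        (shr-xor-fuel f k (y / 2) (z / 2))
  where low-bit = (y % 2 ≡ᵇ 1) xor (z % 2 ≡ᵇ 1)

xor-fuel-bit-set : ∀ {n k y z} → k ≤ n → shr y k ≡ 0 → shr z k ≡ 1 →
                   1 ≤ shr (xor-fuel (suc n) y z) k
xor-fuel-bit-set {n} {k} {y} {z} k≤n yₖ≡0 zₖ≡1
  rewrite shr-xor-fuel (suc n) k y z | +-∸-assoc 1 k≤n | yₖ≡0 | zₖ≡1 = s≤s z≤n

NS⇒shr-h≡0 : ∀ {h} → NSProperty h → ∀ z k → shr z (suc k) ≡ 0 → shr (h z) k ≡ 0
NS⇒shr-h≡0 {h} (h0≡0 , ns) z k zₖ₊₁≡0 = begin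
  shr (h z) k ≡⟨ ns z 0 k (trans zₖ₊₁≡0 (sym (shr-0 (suc k)))) ⟩
  shr (h 0) k ≡⟨ cong (λ w → shr w k) h0≡0 ⟩
  shr 0 k     ≡⟨ shr-0 k ⟩
  0           ∎
  where open ≡-Reasoning

lemma2 : (h : ℕ → ℕ) → Monotone h → NSProperty h →
           ∀ z y → 16 ≤ z → y ≤ h z → 16 ≤ y ⊕ z
lemma2 h _ ns z y 16≤z y≤hz with leading-bit-above 4 z 16≤z
... | k , 4≤k , zₖ≡1 =
  ≤-trans (^-monoʳ-≤ 2 4≤k) (shr-pos⇒2^≤ k (xor-fuel-bit-set k≤y+z yₖ≡0 zₖ≡1))
  where
  hzₖ≡0 : shr (h z) k ≡ 0
  hzₖ≡0 = NS⇒shr-h≡0 ns z k (trans (shr-suc z k) (cong (_/ 2) zₖ≡1))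

  yₖ≡0 : shr y k ≡ 0
  yₖ≡0 = n≤0⇒n≡0 (≤-trans (shr-mono k y≤hz) (≤-reflexive hzₖ≡0))

  k≤y+z : k ≤ y + z
  k≤y+z = ≤-trans (<⇒≤ (n<2^n k))
            (≤-trans (shr-pos⇒2^≤ k (≤-reflexive (sym zₖ≡1))) (m≤n+m z y))
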